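{- Let $G$ be a non-bipartite quadrangulation of $\mathbb{P}^2$ and $S$ an odd support set of $G$ in which every two consecutive vertices are adjacent, so that $S$ is a closed walk in $G$, and suppose this closed walk is non-contractible. Then $G$ contains an odd cycle whose vertex set is contained in the set of vertices of $S$.
   Context: A quadrangulation of the real projective plane $\mathbb{P}^2$ is a graph embedded in $\mathbb{P}^2$ so that every face is bounded by four edges; non-bipartite means the graph is not bipartite. For such $G=(V,E)$, a support set is a circularly ordered sequence of vertices of $V$ (repetitions allowed) such that any two consecutive vertices lie on a common face of $G$. The order of a support set is the number of pairs of consecutive vertices that are adjacent in $G$; the support set is odd if its order is odd. -}

module Defs where

open import Data.Nat using (ℕ; zero; suc; _+_; _%_)
open import Data.Fin using (Fin; _≟_)
open import Data.Fin.Properties using (any?)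
open import Data.Bool using (Bool; true; false; not; _xor_)
open import Data.List using (List; []; _∷_; _++_; zip; map; filter; length)
open import Data.List.Relation.Unary.All using (All)
open import Data.List.Relation.Unary.Unique.Propositional using (Unique)
open import Data.List.Membership.Propositional using (_∈_)
open import Data.Product using (Σ; ∃; _×_; _,_; proj₁; proj₂)
open import Relation.Binary.PropositionalEquality using (_≡_; _≢_)
open import Relation.Nullary using (¬_; Dec)
open import Relation.Nullary.Decidable using (_×-dec_)

data Reach₂ {n : ℕ} (f g : Fin n → Fin n) : Fin n → Fin n → Set where
  rfl   : ∀ {x} → Reach₂ f g x x
  stepf : ∀ {x y} → Reach₂ f g (f x) y → Reach₂ f g x y
  stepg : ∀ {x y} → Reach₂ f g (g x) y → Reach₂ f g x y

data Reach₃ {n : ℕ} (f g h : Fin n → Fin n) : Fin n → Fin n → Set where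
  rfl   : ∀ {x} → Reach₃ f g h x x
  stepf : ∀ {x y} → Reach₃ f g h (f x) y → Reach₃ f g h x y
  stepg : ∀ {x y} → Reach₃ f g h (g x) y → Reach₃ f g h x y
  steph : ∀ {x y} → Reach₃ f g h (h x) y → Reach₃ f g h x y

data ReachP {n : ℕ} (f g : Fin n → Fin n) : Fin n → Fin n → Bool → Set where
  rfl   : ∀ {x} → ReachP f g x x false
  stepf : ∀ {x y b} → ReachP f g (f x) y b → ReachP f g x y (not b)
  stepg : ∀ {x y b} → ReachP f g (g x) y b → ReachP f g x y (not b)

-- Cellular maps on closed surfaces, encoded by flags (Lins' graph-encoded
-- maps / Jones–Singerman combinatorial maps): flags Fin n, three
-- fixed-point-free involutions α₀ (change vertex), α₁ (change edge),
-- α₂ (change face), α₀α₂ = α₂α₀ fixed-point-free, transitive action.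
-- Vertices / edges / faces are the orbits of ⟨α₁,α₂⟩ / ⟨α₀,α₂⟩ / ⟨α₀,α₁⟩,
-- given here by labellings vtx / edg / fac that are complete invariants
-- of these orbit relations (so Fin V, Fin E, Fin F are the vertex, edge
-- and face sets).  The surface is the projective plane iff it is
-- non-orientable (flag graph not bipartite) with Euler characteristic 1.
-- A face is bounded by four edges iff α₀α₁ has period exactly 4 on its
-- flags.

record QuadrangulationP2 : Set where
  field
    n : ℕ
    α₀ α₁ α₂ : Fin n → Fin n
    inv₀ : ∀ x → α₀ (α₀ x) ≡ x
    inv₁ : ∀ x → α₁ (α₁ x) ≡ x
    inv₂ : ∀ x → α₂ (α₂ x) ≡ x
    fpf₀ : ∀ x → α₀ x ≢ x
    fpf₁ : ∀ x → α₁ x ≢ x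
    fpf₂ : ∀ x → α₂ x ≢ x
    comm₀₂ : ∀ x → α₀ (α₂ x) ≡ α₂ (α₀ x)
    fpf₀₂ : ∀ x → α₀ (α₂ x) ≢ x
    connected : ∀ x y → Reach₃ α₀ α₁ α₂ x y
    V E F : ℕ
    vtx : Fin n → Fin V
    edg : Fin n → Fin E
    fac : Fin n → Fin F
    vtx-surj : ∀ u → ∃ λ x → vtx x ≡ u
    edg-surj : ∀ e → ∃ λ x → edg x ≡ e
    fac-surj : ∀ f → ∃ λ x → fac x ≡ f
    vtx-orbit : ∀ x y → (vtx x ≡ vtx y → Reach₂ α₁ α₂ x y) × (Reach₂ α₁ α₂ x y → vtx x ≡ vtx y)
    edg-orbit : ∀ x y → (edg x ≡ edg y → Reach₂ α₀ α₂ x y) × (Reach₂ α₀ α₂ x y → edg x ≡ edg y)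
    fac-orbit : ∀ x y → (fac x ≡ fac y → Reach₂ α₀ α₁ x y) × (Reach₂ α₀ α₁ x y → fac x ≡ fac y)
    nonorientable : ¬ (Σ (Fin n → Bool) λ c → ∀ x → c (α₀ x) ≢ c x × c (α₁ x) ≢ c x × c (α₂ x) ≢ c x)
    euler : V + F ≡ E + 1
    quad : ∀ x → α₀ (α₁ (α₀ (α₁ (α₀ (α₁ (α₀ (α₁ x))))))) ≡ x × α₀ (α₁ x) ≢ x × α₀ (α₁ (α₀ (α₁ x))) ≢ x

module _ (M : QuadrangulationP2) where
  open QuadrangulationP2 M

  Vertex : Set
  Vertex = Fin V

  Adj : Vertex → Vertex → Set
  Adj u w = ∃ λ x → vtx x ≡ u × vtx (α₀ x) ≡ w

  adj? : ∀ u w → Dec (Adj u w)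
  adj? u w = any? (λ x → (vtx x ≟ u) ×-dec (vtx (α₀ x) ≟ w))

  Bipartite : Set
  Bipartite = Σ (Vertex → Bool) λ c → ∀ u w → Adj u w → c u ≢ c w

  CommonFace : Vertex → Vertex → Set
  CommonFace u w = ∃ λ x → ∃ λ y → fac x ≡ fac y × vtx x ≡ u × vtx y ≡ w

cyclicPairs : {A : Set} → List A → List (A × A)
cyclicPairs []       = []
cyclicPairs (x ∷ xs) = zip (x ∷ xs) (xs ++ x ∷ [])

IsOdd : ℕ → Set
IsOdd k = k % 2 ≡ 1

module _ (M : QuadrangulationP2) where
  open QuadrangulationP2 M

  IsSupportSet : List (Fin V) → Set
  IsSupportSet S = S ≢ [] × All (λ p → CommonFace M (proj₁ p) (proj₂ p)) (cyclicPairs S)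

  order : List (Fin V) → ℕ
  order S = length (filter (λ p → adj? M (proj₁ p) (proj₂ p)) (cyclicPairs S))

  AllConsecutiveAdjacent : List (Fin V) → Set
  AllConsecutiveAdjacent S = All (λ p → Adj M (proj₁ p) (proj₂ p)) (cyclicPairs S)

  -- A closed walk in G is encoded by flags x₀ … x_{k-1}: step i traverses
  -- the edge of x_i from vtx x_i to vtx (α₀ x_i), then turns around that
  -- vertex (by a word in α₁, α₂) to x_{i+1}.  The parity of the total
  -- closed flag word (one α₀ per edge plus the turning words) is the
  -- orientation character of the loop; in ℙ² a closed walk is
  -- non-contractible iff it is orientation-reversing, i.e. iff this parity
  -- is odd.
  data WalkParity : List (Fin n × Fin n) → Bool → Set where
    nil  : WalkParity [] false
    cons : ∀ {x y b c ps} → ReachP α₁ α₂ (α₀ x) y b → WalkParity ps c →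
           WalkParity ((x , y) ∷ ps) (not b xor c)

  NonContractibleWalk : List (Fin V) → Set
  NonContractibleWalk S = ∃ λ (xs : List (Fin n)) → map vtx xs ≡ S × WalkParity (cyclicPairs xs) true

  -- an odd cycle of G (distinct vertices, cyclically adjacent, odd length;
  -- length 1 = a loop) whose vertices all belong to S
  OddCycleWithin : List (Fin V) → Set
  OddCycleWithin S = ∃ λ (c : List (Fin V)) →
    Unique c × IsOdd (length c) × All (λ p → Adj M (proj₁ p) (proj₂ p)) (cyclicPairs c) × All (_∈ S) c

{-# OPTIONS --safe #-}
module Submission where

-- A closed walk that passes some vertex twice splits there into two shorter closed
-- walks whose lengths add up to its own, so one of them is again odd; iterating
-- ends at an odd closed walk without repeated vertices, i.e. an odd cycle.  Since
-- all consecutive vertices of S are adjacent, the order of S is its length, so S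
-- itself is such an odd closed walk.

open import Defs
open import Data.Fin using (Fin)
import Data.Fin as Fin
open import Data.Nat using (zero; suc; _+_; _<_; z<s; s≤s)
open import Data.Nat.Induction using (<-wellFounded)
open import Data.Nat.Properties using (m<m+n; m≤n+m)
open import Data.List using (List; []; _∷_; _++_; zip; length)
open import Data.List.Properties using (length-++; length-++-sucʳ; filter-all)
open import Data.List.Relation.Unary.All as All using (All)
open import Data.List.Relation.Unary.All.Properties using (¬Any⇒All¬; ++⁻)
open import Data.List.Relation.Unary.AllPairs using ([]; _∷_)
open import Data.List.Relation.Unary.Unique.Propositional using (Unique)
open import Data.List.Membership.Propositional using (_∈_)
open import Data.List.Membership.Propositional.Properties using (∈-∃++)
open import Data.List.Membership.DecPropositional using (_∈?_)
open import Data.List.Relation.Binary.Permutation.Propositional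
  using (_↭_; ↭-reflexive; ↭-sym; module PermutationReasoning)
open import Data.List.Relation.Binary.Permutation.Propositional.Properties
  using (shifts; ↭-length; All-resp-↭)
open import Data.List.Relation.Binary.Subset.Propositional using (_⊆_)
open import Data.List.Relation.Binary.Subset.Propositional.Properties
  using (⊆-respʳ-↭; xs⊆xs++ys; xs⊆ys++xs)
open import Data.Product using (∃; _×_; _,_; proj₁; proj₂; uncurry)
open import Data.Sum using (_⊎_; inj₁; inj₂)
open import Function using (id)
open import Induction.WellFounded using (Acc; acc)
open import Relation.Nullary using (¬_; yes; no)
open import Relation.Binary.Definitions using (DecidableEquality)
open import Relation.Binary.PropositionalEquality using (_≡_; refl; sym; trans; cong; subst)

-- IsOdd (2 + k) reduces to IsOdd k, since _%_ computes on numerals.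
odd-+⁻ : ∀ m {n} → IsOdd (m + n) → IsOdd m ⊎ IsOdd n
odd-+⁻ zero          odd = inj₂ odd
odd-+⁻ (suc zero)    _   = inj₁ refl
odd-+⁻ (suc (suc m)) odd = odd-+⁻ m odd

module _ {A : Set} where

  steps : A → List A → A → List (A × A)
  steps a xs b = zip (a ∷ xs) (xs ++ b ∷ [])

  steps-++ : ∀ a xs y ys (b : A) → steps a (xs ++ y ∷ ys) b ≡ steps a xs y ++ steps y ys b
  steps-++ a []       y ys b = refl
  steps-++ a (x ∷ xs) y ys b = cong ((a , x) ∷_) (steps-++ x xs y ys b)

  length-steps : ∀ a xs (b : A) → length (steps a xs b) ≡ suc (length xs)
  length-steps a []       b = refl
  length-steps a (x ∷ xs) b = cong suc (length-steps x xs b)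

  length-cyclicPairs : (xs : List A) → length (cyclicPairs xs) ≡ length xs
  length-cyclicPairs []       = refl
  length-cyclicPairs (x ∷ xs) = length-steps x xs x

  cyclicPairs-split : ∀ pre (a : A) mid post →
    cyclicPairs (pre ++ a ∷ mid ++ a ∷ post) ↭ cyclicPairs (a ∷ mid) ++ cyclicPairs (pre ++ a ∷ post)
  cyclicPairs-split []        a mid post = ↭-reflexive (steps-++ a mid a post a)
  cyclicPairs-split (h ∷ pre) a mid post = begin
    steps h (pre ++ a ∷ mid ++ a ∷ post) h            ≡⟨ steps-++ h pre a (mid ++ a ∷ post) h ⟩
    steps h pre a ++ steps a (mid ++ a ∷ post) h      ≡⟨ cong (steps h pre a ++_) (steps-++ a mid a post h) ⟩
    steps h pre a ++ steps a mid a ++ steps a post h  ↭⟨ shifts (steps h pre a) (steps a mid a) ⟩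
    steps a mid a ++ steps h pre a ++ steps a post h  ≡⟨ cong (steps a mid a ++_) (steps-++ h pre a post h) ⟨
    steps a mid a ++ steps h (pre ++ a ∷ post) h      ∎
    where open PermutationReasoning

  data Duplicate : List A → Set where
    duplicate : ∀ pre a mid post → Duplicate (pre ++ a ∷ mid ++ a ∷ post)

  unique⊎duplicate : DecidableEquality A → (xs : List A) → Unique xs ⊎ Duplicate xs
  unique⊎duplicate _≟_ []       = inj₁ []
  unique⊎duplicate _≟_ (x ∷ xs) with _∈?_ _≟_ x xs
  ... | yes x∈xs with mid , post , refl ← ∈-∃++ x∈xs = inj₂ (duplicate [] x mid post)
  ... | no  x∉xs with unique⊎duplicate _≟_ xs
  ...   | inj₁ unique                     = inj₁ (¬Any⇒All¬ xs x∉xs ∷ unique)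
  ...   | inj₂ (duplicate pre a mid post)     = inj₂ (duplicate (x ∷ pre) a mid post)

  duplicate-↭ : ∀ pre (a : A) mid post → pre ++ a ∷ mid ++ a ∷ post ↭ (a ∷ mid) ++ pre ++ a ∷ post
  duplicate-↭ pre a mid post = shifts pre (a ∷ mid)

  duplicate-⊆ˡ : ∀ pre (a : A) mid post → a ∷ mid ⊆ pre ++ a ∷ mid ++ a ∷ post
  duplicate-⊆ˡ pre a mid post = ⊆-respʳ-↭ (↭-sym (duplicate-↭ pre a mid post)) (xs⊆xs++ys (a ∷ mid) _)

  duplicate-⊆ʳ : ∀ pre (a : A) mid post → pre ++ a ∷ post ⊆ pre ++ a ∷ mid ++ a ∷ post
  duplicate-⊆ʳ pre a mid post = ⊆-respʳ-↭ (↭-sym (duplicate-↭ pre a mid post)) (xs⊆ys++xs _ (a ∷ mid))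

  duplicate-length : ∀ pre (a : A) mid post →
    length (pre ++ a ∷ mid ++ a ∷ post) ≡ length (a ∷ mid) + length (pre ++ a ∷ post)
  duplicate-length pre a mid post = trans (↭-length (duplicate-↭ pre a mid post)) (length-++ (a ∷ mid))

  duplicate-shorterˡ : ∀ pre (a : A) mid post → length (a ∷ mid) < length (pre ++ a ∷ mid ++ a ∷ post)
  duplicate-shorterˡ pre a mid post = subst (_ <_) (sym (duplicate-length pre a mid post))
    (m<m+n _ (subst (0 <_) (sym (length-++-sucʳ pre a post)) z<s))

  duplicate-shorterʳ : ∀ pre (a : A) mid post → length (pre ++ a ∷ post) < length (pre ++ a ∷ mid ++ a ∷ post)
  duplicate-shorterʳ pre a mid post = subst (_ <_) (sym (duplicate-length pre a mid post))
    (s≤s (m≤n+m _ (length mid)))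

module _ {A : Set} (R : A → A → Set) where

  ClosedWalk : List A → Set
  ClosedWalk xs = All (uncurry R) (cyclicPairs xs)

  closedWalk-split : ∀ pre a mid post → ClosedWalk (pre ++ a ∷ mid ++ a ∷ post) →
                     ClosedWalk (a ∷ mid) × ClosedWalk (pre ++ a ∷ post)
  closedWalk-split pre a mid post walk =
    ++⁻ (cyclicPairs (a ∷ mid)) (All-resp-↭ (cyclicPairs-split pre a mid post) walk)

  OddCycleIn : List A → Set
  OddCycleIn xs = ∃ λ (c : List A) →
    Unique c × IsOdd (length c) × ClosedWalk c × All (_∈ xs) c

  oddCycleIn-mono : ∀ {xs ys} → xs ⊆ ys → OddCycleIn xs → OddCycleIn ys
  oddCycleIn-mono xs⊆ys (c , unique , odd , walk , c⊆xs) = c , unique , odd , walk , All.map xs⊆ys c⊆xs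

  module _ (_≟_ : DecidableEquality A) where

    oddClosedWalk⇒oddCycle-acc : ∀ xs → Acc _<_ (length xs) →
      ClosedWalk xs → IsOdd (length xs) → OddCycleIn xs
    oddClosedWalk⇒oddCycle-acc xs (acc rec) walk odd with unique⊎duplicate _≟_ xs
    ... | inj₁ unique = xs , unique , odd , walk , All.tabulate id
    ... | inj₂ (duplicate pre a mid post)
      with walk₁ , walk₂ ← closedWalk-split pre a mid post walk
         | odd-+⁻ (length (a ∷ mid)) (subst IsOdd (duplicate-length pre a mid post) odd)
    ...  | inj₁ odd₁ = oddCycleIn-mono (duplicate-⊆ˡ pre a mid post)
      (oddClosedWalk⇒oddCycle-acc (a ∷ mid) (rec (duplicate-shorterˡ pre a mid post)) walk₁ odd₁)
    ...  | inj₂ odd₂ = oddCycleIn-mono (duplicate-⊆ʳ pre a mid post)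
      (oddClosedWalk⇒oddCycle-acc (pre ++ a ∷ post) (rec (duplicate-shorterʳ pre a mid post)) walk₂ odd₂)

    oddClosedWalk⇒oddCycle : ∀ xs → ClosedWalk xs → IsOdd (length xs) → OddCycleIn xs
    oddClosedWalk⇒oddCycle xs = oddClosedWalk⇒oddCycle-acc xs (<-wellFounded (length xs))

order≡length : (G : QuadrangulationP2) (S : List (Fin (QuadrangulationP2.V G))) →
               AllConsecutiveAdjacent G S → order G S ≡ length S
order≡length G S adjacent = trans
  (cong length (filter-all (λ p → adj? G (proj₁ p) (proj₂ p)) adjacent))
  (length-cyclicPairs S)

lemma2p4 : (G : QuadrangulationP2) → ¬ Bipartite G →
           (S : List (Fin (QuadrangulationP2.V G))) →
           IsSupportSet G S → IsOdd (order G S) → AllConsecutiveAdjacent G S →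
           NonContractibleWalk G S → OddCycleWithin G S
lemma2p4 G _ S _ odd adjacent _ =
  oddClosedWalk⇒oddCycle (Adj G) Fin._≟_ S adjacent (subst IsOdd (order≡length G S adjacent) odd)
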